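{- Let $\alpha, r$ be positive integers. Any $r$-uniform $r$-partite hypergraph $\mathcal H$ with parts $V_1,\dots,V_r$ contains edge-disjoint subhypergraphs $\mathcal A$ and $\mathcal B$ such that (a) for every $S \subseteq V(\mathcal H)$ with $|S| = r-1$, either $\deg_{\mathcal A}(S) = 0$ or $\deg_{\mathcal A}(S) \geq \alpha$; (b) $|\mathcal B| \geq \frac{|\mathcal H \setminus \mathcal A|}{\alpha - 1}$ and $|\mathcal B| \leq \sum_{s=1}^r |\mathcal B[\overline{s}]|$.
   Context: An $r$-uniform hypergraph is a family of $r$-element subsets (edges) of a finite vertex set; it is $r$-partite with parts $V_1,\dots,V_r$ if $V(\mathcal H)=V_1\cup\dots\cup V_r$ is a partition and every edge meets each $V_i$ in exactly one vertex. A subhypergraph is a subfamily of the edges; $\mathcal H\setminus\mathcal A$ is the set of edges of $\mathcal H$ not in $\mathcal A$, and $|\cdot|$ counts edges. For a set $S$ of vertices, $\deg_{\mathcal A}(S)$ is the number of edges of $\mathcal A$ containing $S$. For an edge $e$ and $1\le s\le r$, $e[\overline{s}] = e\setminus V_s$, and for a family $\mathcal B$, $\mathcal B[\overline{s}]=\{e[\overline{s}]: e\in\mathcal B\}$ (as a set, so repeated traces count once). -}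

module Defs where

open import Data.Nat using (ℕ; suc; _+_)
open import Data.Nat.Properties using (_≟_)
open import Data.Fin using (Fin)
open import Data.Vec using (Vec; lookup; removeAt)
open import Data.Vec.Properties using (≡-dec)
open import Data.List using (List; length; filter; deduplicate; map; allFin)
open import Data.Nat.ListAction using (sum)
open import Data.List.Relation.Unary.All using (All; all?)
open import Data.List.Relation.Unary.Unique.Propositional using (Unique)
open import Data.List.Membership.Propositional using (_∈_; _∉_)
open import Data.List.Membership.DecPropositional using () renaming (_∈?_ to mem?)
open import Data.Product using (_×_; _,_; proj₁; proj₂)
open import Relation.Nullary using (¬?)
open import Relation.Binary.PropositionalEquality using (_≡_)

-- Convention: an r-partite r-uniform hypergraph, r = suc k, with parts
-- V_1..V_r indexed by s : Fin r.  The vertices of part s are labelled by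
-- natural numbers; the vertex with label v in part s is the pair (s , v).
-- An edge meets each part in exactly one vertex, so it is a vector
-- e : Vec ℕ r whose s-th entry is the label of its vertex in V_s.

Vertex : ℕ → Set
Vertex r = Fin r × ℕ

Edge : ℕ → Set
Edge r = Vec ℕ r

-- A family of edges (hypergraph or subhypergraph): a duplicate-free list.
Family : ℕ → Set
Family r = List (Edge r)

_∈ᵉ_ : ∀ {r} → Vertex r → Edge r → Set
(s , v) ∈ᵉ e = lookup e s ≡ v

_⊆ᵉ_ : ∀ {r} → List (Vertex r) → Edge r → Set
S ⊆ᵉ e = All (λ x → x ∈ᵉ e) S

_⊆ᵉ?_ : ∀ {r} (S : List (Vertex r)) (e : Edge r) → Relation.Nullary.Dec (S ⊆ᵉ e)
S ⊆ᵉ? e = all? (λ x → lookup e (proj₁ x) ≟ proj₂ x) S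

deg : ∀ {r} → Family r → List (Vertex r) → ℕ
deg A S = length (filter (S ⊆ᵉ?_) A)

edge? : ∀ {r} → (x y : Edge r) → Relation.Nullary.Dec (x ≡ y)
edge? = ≡-dec _≟_

_∖_ : ∀ {r} → Family r → Family r → Family r
H ∖ A = filter (λ e → ¬? (mem? edge? e A)) H

trace : ∀ {k} → Fin (suc k) → Edge (suc k) → Vec ℕ k
trace s e = removeAt e s

traces : ∀ {k} → Fin (suc k) → Family (suc k) → List (Vec ℕ k)
traces s B = deduplicate (≡-dec _≟_) (map (trace s) B)

traceSum : ∀ {k} → Family (suc k) → ℕ
traceSum {k} B = sum (map (λ s → length (traces s B)) (allFin (suc k)))

IsHypergraph : ∀ {r} → (Fin r → List ℕ) → Family r → Set
IsHypergraph V H = Unique H × All (λ e → ∀ s → lookup e s ∈ V s) H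

IsSub : ∀ {r} → Family r → Family r → Set
IsSub A H = Unique A × All (λ e → e ∈ H) A

EdgeDisjoint : ∀ {r} → Family r → Family r → Set
EdgeDisjoint A B = ∀ e → e ∈ A → e ∉ B

InVertexSet : ∀ {r} → (Fin r → List ℕ) → List (Vertex r) → Set
InVertexSet V S = All (λ x → proj₂ x ∈ V (proj₁ x)) S

-- Peel the hypergraph greedily: while some edge e of the current family A
-- has, in some part s, fewer than α edges with the same trace e[s̄], delete
-- that whole trace class (between 1 and α - 1 edges) from A and put e into B.
-- The final A is closed: every edge has at least α twins in every part.  An
-- (r-1)-set S inside an edge e of A misses some part s, so all s-twins of e
-- contain S, whence deg_A(S) ≥ α.  Each step removes at most α - 1 edges and
-- adds one edge to B, and the recorded pairs (s, e[s̄]) are distinct (a later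
-- edge survived the deletion of every earlier class), so they inject into
-- the disjoint union of the trace sets B[s̄].
module Submission where

open import Defs
open import Data.Nat using (ℕ; suc; _≤_; _<_; _*_; _∸_; _+_; _≤?_; z≤n; s≤s)
open import Data.Nat.Properties
open import Data.Nat.Induction using (<-wellFounded)
open import Data.Nat.ListAction using (sum)
open import Data.Fin using (Fin; punchOut)
import Data.Fin.Properties as Fin
open import Data.List using (List; []; _∷_; length; filter; map; _++_; allFin; concatMap)
open import Data.List.Properties using (length-++; length-map; length-tabulate; map-cong; filter-notAll)
open import Data.List.Relation.Unary.All as All using (All; []; _∷_; all?)
import Data.List.Relation.Unary.All.Properties as All
open import Data.List.Relation.Unary.Any using (here; there)
open import Data.List.Relation.Unary.Unique.Propositional using (Unique; []; _∷_)
import Data.List.Relation.Unary.Unique.Propositional.Properties as Unique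
open import Data.List.Relation.Binary.Disjoint.Propositional using (Disjoint)
open import Data.List.Relation.Binary.Subset.Propositional using (_⊆_)
import Data.List.Relation.Binary.Sublist.Propositional as Sublist
import Data.List.Relation.Binary.Sublist.Propositional.Properties as Sublist
open import Data.List.Membership.Propositional using (_∈_; _∉_; find; lose)
open import Data.List.Membership.Propositional.Properties
  using (∈-map⁺; ∈-map⁻; ∈-++⁻; ∈-++⁺ˡ; ∈-++⁺ʳ; ∈-∃++; ∈-filter⁻; ∈-allFin; ∈-concatMap⁺; ∈-deduplicate⁺)
open import Data.List.Membership.DecPropositional using () renaming (_∈?_ to mem?)
open import Data.Vec using (Vec; lookup; removeAt)
open import Data.Vec.Properties using (≡-dec; removeAt-punchOut)
open import Data.Product using (Σ; Σ-syntax; ∃; _×_; _,_; proj₁; proj₂)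
open import Data.Product.Properties using (,-injectiveˡ; ,-injectiveʳ)
open import Data.Sum using (_⊎_; inj₁; inj₂)
open import Function using (_∘_; id)
open import Induction.WellFounded using (Acc; acc)
open import Level using (0ℓ)
open import Relation.Nullary using (¬_; ¬?; yes; no; contradiction)
open import Relation.Unary using (Pred; Decidable)
open import Relation.Binary.Definitions using (DecidableEquality)
open import Relation.Binary.PropositionalEquality using (_≡_; _≢_; refl; trans; cong; subst; module ≡-Reasoning)

module _ {X : Set} where

  length-filter-∁ : {P : Pred X 0ℓ} (P? : Decidable P) (xs : List X) →
                    length (filter P? xs) + length (filter (¬? ∘ P?) xs) ≡ length xs
  length-filter-∁ P? []       = refl
  length-filter-∁ P? (x ∷ xs) with P? x
  ... | yes _ = cong suc (length-filter-∁ P? xs)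
  ... | no  _ = trans (+-suc _ _) (cong suc (length-filter-∁ P? xs))

  length≡0⊎∃∈ : (xs : List X) → length xs ≡ 0 ⊎ ∃ (_∈ xs)
  length≡0⊎∃∈ []      = inj₁ refl
  length≡0⊎∃∈ (x ∷ _) = inj₂ (x , here refl)

  Unique-⊆⇒length≤ : {xs ys : List X} → Unique xs → xs ⊆ ys → length xs ≤ length ys
  Unique-⊆⇒length≤ {[]}     _             _     = z≤n
  Unique-⊆⇒length≤ {x ∷ xs} (x∉xs ∷ xs!) xs⊆ys with ∈-∃++ (xs⊆ys (here refl))
  ... | as , bs , refl = begin
      suc (length xs)              ≤⟨ s≤s (Unique-⊆⇒length≤ xs! xs⊆as++bs) ⟩
      suc (length (as ++ bs))      ≡⟨ cong suc (length-++ as) ⟩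
      suc (length as + length bs)  ≡⟨ +-suc (length as) (length bs) ⟨
      length as + suc (length bs)  ≡⟨ length-++ as ⟨
      length (as ++ x ∷ bs)        ∎
    where
    open ≤-Reasoning
    xs⊆as++bs : xs ⊆ as ++ bs
    xs⊆as++bs {y} y∈xs with ∈-++⁻ as (xs⊆ys (there y∈xs))
    ... | inj₁ y∈as         = ∈-++⁺ˡ y∈as
    ... | inj₂ (here refl)  = contradiction refl (All.lookup x∉xs y∈xs)
    ... | inj₂ (there y∈bs) = ∈-++⁺ʳ as y∈bs

length-concatMap : {A B : Set} (f : A → List B) (xs : List A) →
                   length (concatMap f xs) ≡ sum (map (length ∘ f) xs)
length-concatMap f []       = refl
length-concatMap f (x ∷ xs) = trans (length-++ (f x)) (cong (length (f x) +_) (length-concatMap f xs))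

length<⇒∃∉ : ∀ {n} (is : List (Fin n)) → length is < n → ∃ λ i → i ∉ is
length<⇒∃∉ {n} is short = Fin.¬∀⟶∃¬ n (_∈ is) (λ i → mem? Fin._≟_ i is) notAll
  where
  notAll : ¬ (∀ i → i ∈ is)
  notAll all∈ = <⇒≱ short (subst (_≤ length is) (length-tabulate id)
                  (Unique-⊆⇒length≤ (Unique.allFin⁺ n) (λ {i} _ → all∈ i)))

module Peeling {X Y : Set} (_≟_ : DecidableEquality Y) {n : ℕ} (π : Fin n → X → Y) where

  Twin : Fin n → X → X → Set
  Twin s x y = π s y ≡ π s x

  twin? : ∀ s x → Decidable (Twin s x)
  twin? s x y = π s y ≟ π s x

  twins : List X → Fin n → X → List X
  twins A s x = filter (twin? s x) A

  Tag : Set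
  Tag = Fin n × X

  class : Tag → Fin n × Y
  class (s , x) = s , π s x

  class≡⇒twin : ∀ {s x t} → class (s , x) ≡ class t → Twin (proj₁ t) (proj₂ t) x
  class≡⇒twin {t = _ , _} same with refl ← ,-injectiveˡ same = ,-injectiveʳ same

  module _ (α : ℕ) where

    Closed : List X → Set
    Closed A = All (λ x → ∀ s → α ≤ length (twins A s x)) A

    closed? : Decidable Closed
    closed? A = all? (λ x → Fin.all? (λ s → α ≤? length (twins A s x))) A

    ¬closed⇒light : ∀ {A} → ¬ Closed A → ∃ λ x → x ∈ A × ∃ λ s → length (twins A s x) < α
    ¬closed⇒light {A} ¬closed
      with x , x∈A , ¬heavy ← find (All.¬All⇒Any¬ (λ x → Fin.all? (λ s → α ≤? length (twins A s x))) A ¬closed)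
      with s , ¬α≤ ← Fin.¬∀⟶∃¬ n _ (λ s → α ≤? length (twins A s x)) ¬heavy
      = x , x∈A , s , ≰⇒> ¬α≤

  module _ (H : List X) where

    survivors : List Tag → List X
    survivors []            = H
    survivors ((s , x) ∷ T) = filter (¬? ∘ twin? s x) (survivors T)

    survivors-⊆ : ∀ T → survivors T ⊆ H
    survivors-⊆ []            = id
    survivors-⊆ ((s , x) ∷ T) = survivors-⊆ T ∘ proj₁ ∘ ∈-filter⁻ (¬? ∘ twin? s x) {xs = survivors T}

    survivors-unique : Unique H → ∀ T → Unique (survivors T)
    survivors-unique H! []            = H!
    survivors-unique H! ((s , x) ∷ T) = Unique.filter⁺ (¬? ∘ twin? s x) (survivors-unique H! T)

    survivor-not-twin : ∀ {T t y} → t ∈ T → y ∈ survivors T → ¬ Twin (proj₁ t) (proj₂ t) y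
    survivor-not-twin {(s , x) ∷ T} (here refl) y∈ = proj₂ (∈-filter⁻ (¬? ∘ twin? s x) {xs = survivors T} y∈)
    survivor-not-twin {(s , x) ∷ T} (there t∈)  y∈ =
      survivor-not-twin t∈ (proj₁ (∈-filter⁻ (¬? ∘ twin? s x) {xs = survivors T} y∈))

    survivors-disjoint-tagged : ∀ {T x} → x ∈ survivors T → x ∉ map proj₂ T
    survivors-disjoint-tagged x∈ x∈tagged with t , t∈ , refl ← ∈-map⁻ proj₂ x∈tagged =
      survivor-not-twin t∈ x∈ refl

    survivors-shrink : ∀ {T s x} → x ∈ survivors T → length (survivors ((s , x) ∷ T)) < length (survivors T)
    survivors-shrink {T} {s} {x} x∈ = filter-notAll (¬? ∘ twin? s x) (survivors T) (lose x∈ λ ¬twin → ¬twin refl)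

  module _ (α : ℕ) (H : List X) where

    data PeelingSequence : List Tag → Set where
      []   : PeelingSequence []
      step : ∀ {T s x} → PeelingSequence T → x ∈ survivors H T → length (twins (survivors H T) s x) < α →
             PeelingSequence ((s , x) ∷ T)

    peeling-elements-∈ : ∀ {T} → PeelingSequence T → All (_∈ H) (map proj₂ T)
    peeling-elements-∈ []                = []
    peeling-elements-∈ (step {T} P x∈ _) = survivors-⊆ H T x∈ ∷ peeling-elements-∈ P

    peeling-elements-unique : ∀ {T} → PeelingSequence T → Unique (map proj₂ T)
    peeling-elements-unique []                = []
    peeling-elements-unique (step {T} P x∈ _) =
      All.¬Any⇒All¬ (map proj₂ T) (survivors-disjoint-tagged H x∈) ∷ peeling-elements-unique P

    peeling-classes-unique : ∀ {T} → PeelingSequence T → Unique (map class T)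
    peeling-classes-unique []            = []
    peeling-classes-unique (step P x∈ _) =
      All.map⁺ (All.tabulate λ t∈ same → survivor-not-twin H t∈ x∈ (class≡⇒twin same))
        ∷ peeling-classes-unique P

    peeling-count : ∀ {T} → PeelingSequence T → length H ≤ length (survivors H T) + (α ∸ 1) * length T
    peeling-count []                             = m≤m+n (length H) _
    peeling-count (step {T} {s} {x} P _ light) = begin
        length H                                    ≤⟨ peeling-count P ⟩
        length A + a * t                            ≡⟨ cong (_+ a * t) (length-filter-∁ (twin? s x) A) ⟨
        (length (twins A s x) + length A') + a * t  ≤⟨ +-monoˡ-≤ (a * t) (+-monoˡ-≤ (length A') class≤a) ⟩
        (a + length A') + a * t                     ≡⟨ cong (_+ a * t) (+-comm a (length A')) ⟩
        (length A' + a) + a * t                     ≡⟨ +-assoc (length A') a (a * t) ⟩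
        length A' + (a + a * t)                     ≡⟨ cong (length A' +_) (*-suc a t) ⟨
        length A' + a * suc t                       ∎
      where
      open ≤-Reasoning
      A = survivors H T
      A' = survivors H ((s , x) ∷ T)
      a = α ∸ 1
      t = length T
      class≤a : length (twins A s x) ≤ a
      class≤a = subst (length (twins A s x) ≤_) (pred[m∸n]≡m∸[1+n] α 0) (<⇒≤pred light)

    peel-from : ∀ {T} → PeelingSequence T → Acc _<_ (length (survivors H T)) →
                Σ[ T' ∈ List Tag ] PeelingSequence T' × Closed α (survivors H T')
    peel-from {T} P (acc smaller) with closed? α (survivors H T)
    ... | yes closed = T , P , closed
    ... | no ¬closed with x , x∈ , s , light ← ¬closed⇒light α ¬closed =
      peel-from (step P x∈ light) (smaller (survivors-shrink H {T} {s} x∈))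

    peel : Σ[ T ∈ List Tag ] PeelingSequence T × Closed α (survivors H T)
    peel = peel-from [] (<-wellFounded _)

module _ {k : ℕ} where

  open Peeling (≡-dec _≟_) (trace {k})

  trace≡⇒lookup≡ : ∀ {s t} (e e' : Edge (suc k)) → s ≢ t → trace s e ≡ trace s e' → lookup e t ≡ lookup e' t
  trace≡⇒lookup≡ {s} {t} e e' s≢t same = begin
      lookup e t                             ≡⟨ removeAt-punchOut e s≢t ⟨
      lookup (removeAt e s) (punchOut s≢t)   ≡⟨ cong (λ v → lookup v (punchOut s≢t)) same ⟩
      lookup (removeAt e' s) (punchOut s≢t)  ≡⟨ removeAt-punchOut e' s≢t ⟩
      lookup e' t                            ∎
    where open ≡-Reasoning

  ⊆ᵉ-twin : ∀ {S s e e'} → s ∉ map proj₁ S → Twin s e e' → S ⊆ᵉ e → S ⊆ᵉ e'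
  ⊆ᵉ-twin {[]}          _  _    []             = []
  ⊆ᵉ-twin {(t , v) ∷ S} {s} {e} {e'} s∉ twin (e∋v ∷ S⊆e) =
    trans (trace≡⇒lookup≡ e' e s≢t twin) e∋v ∷ ⊆ᵉ-twin {e = e} {e'} (s∉ ∘ there) twin S⊆e
    where
    s≢t : s ≢ t
    s≢t refl = s∉ (here refl)

  twins≤deg : ∀ {S s} (A : Family (suc k)) (e : Edge (suc k)) → s ∉ map proj₁ S → S ⊆ᵉ e →
              length (twins A s e) ≤ deg A S
  twins≤deg {S} {s} A e s∉ S⊆e = Sublist.length-mono-≤ twins⊑
    where
    twins⊑ : Sublist._⊆_ (twins A s e) (filter (S ⊆ᵉ?_) A)
    twins⊑ = Sublist.filter⁺ (twin? s e) (S ⊆ᵉ?_) (λ { {e'} refl twin → ⊆ᵉ-twin {e = e} {e'} s∉ twin S⊆e })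
               (Sublist.⊆-refl {x = A})

  closed⇒deg : ∀ {α A} → Closed α A → ∀ S → length S ≡ k → deg A S ≡ 0 ⊎ α ≤ deg A S
  closed⇒deg {A = A} closed S |S|≡k with length≡0⊎∃∈ (filter (S ⊆ᵉ?_) A)
  ... | inj₁ none = inj₁ none
  ... | inj₂ (e , e∈)
    with e∈A , S⊆e ← ∈-filter⁻ (S ⊆ᵉ?_) {xs = A} e∈
    with s , s∉ ← length<⇒∃∉ (map proj₁ S) (s≤s (≤-reflexive (trans (length-map proj₁ S) |S|≡k)))
    = inj₂ (≤-trans (All.lookup closed e∈A s) (twins≤deg A e s∉ S⊆e))

  traceClasses : Family (suc k) → List (Fin (suc k) × Vec ℕ k)
  traceClasses B = concatMap (λ s → map (s ,_) (traces s B)) (allFin (suc k))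

  length-traceClasses : ∀ B → length (traceClasses B) ≡ traceSum B
  length-traceClasses B = trans (length-concatMap (λ s → map (s ,_) (traces s B)) (allFin (suc k)))
    (cong sum (map-cong (λ s → length-map (s ,_) (traces s B)) (allFin (suc k))))

  class∈traceClasses : ∀ {B e} s → e ∈ B → class (s , e) ∈ traceClasses B
  class∈traceClasses {B} s e∈B =
    ∈-concatMap⁺ (λ s → map (s ,_) (traces s B))
      (lose (∈-allFin s) (∈-map⁺ (s ,_) (∈-deduplicate⁺ (≡-dec _≟_) (∈-map⁺ (trace s) e∈B))))

  length≤traceSum : ∀ T → Unique (map class T) → length (map proj₂ T) ≤ traceSum (map proj₂ T)
  length≤traceSum T classes! = begin
      length (map proj₂ T)     ≡⟨ length-map proj₂ T ⟩
      length T                 ≡⟨ length-map class T ⟨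
      length (map class T)     ≤⟨ Unique-⊆⇒length≤ classes! classes⊆ ⟩
      length (traceClasses B)  ≡⟨ length-traceClasses B ⟩
      traceSum B               ∎
    where
    open ≤-Reasoning
    B = map proj₂ T
    classes⊆ : map class T ⊆ traceClasses B
    classes⊆ c∈ with (s , e) , t∈ , refl ← ∈-map⁻ class c∈ = class∈traceClasses s (∈-map⁺ proj₂ t∈)

  length-∖+length≤ : ∀ {H A : Family (suc k)} → Unique H → Unique A → A ⊆ H → length (H ∖ A) + length A ≤ length H
  length-∖+length≤ {H} {A} H! A! A⊆H = begin
      length (H ∖ A) + length A  ≡⟨ length-++ (H ∖ A) ⟨
      length (H ∖ A ++ A)        ≤⟨ Unique-⊆⇒length≤ (Unique.++⁺ (Unique.filter⁺ notInA? H!) A! disjoint) covered ⟩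
      length H                   ∎
    where
    open ≤-Reasoning
    notInA? : Decidable (_∉ A)
    notInA? e = ¬? (mem? edge? e A)
    disjoint : Disjoint (H ∖ A) A
    disjoint (e∈H∖A , e∈A) = proj₂ (∈-filter⁻ notInA? {xs = H} e∈H∖A) e∈A
    covered : H ∖ A ++ A ⊆ H
    covered e∈ with ∈-++⁻ (H ∖ A) e∈
    ... | inj₁ e∈H∖A = proj₁ (∈-filter⁻ notInA? {xs = H} e∈H∖A)
    ... | inj₂ e∈A   = A⊆H e∈A

  peeling-removed≤ : ∀ {α H T} → Unique H → PeelingSequence α H T →
                     length (H ∖ survivors H T) ≤ (α ∸ 1) * length (map proj₂ T)
  peeling-removed≤ {α} {H} {T} H! P = +-cancelʳ-≤ (length A) _ _ (begin
      length (H ∖ A) + length A                  ≤⟨ length-∖+length≤ H! (survivors-unique H H! T) (survivors-⊆ H T) ⟩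
      length H                                   ≤⟨ peeling-count α H P ⟩
      length A + (α ∸ 1) * length T              ≡⟨ +-comm (length A) _ ⟩
      (α ∸ 1) * length T + length A              ≡⟨ cong (λ l → (α ∸ 1) * l + length A) (length-map proj₂ T) ⟨
      (α ∸ 1) * length (map proj₂ T) + length A  ∎)
    where
    open ≤-Reasoning
    A = survivors H T

theorem3p2 : (α k : ℕ) → 1 ≤ α → (V : Fin (suc k) → List ℕ) → (H : Family (suc k)) → IsHypergraph V H
    → Σ (Family (suc k)) λ A → Σ (Family (suc k)) λ B →
      IsSub A H × IsSub B H × EdgeDisjoint A B
      × (∀ (S : List (Vertex (suc k))) → Unique S → length S ≡ k → InVertexSet V S → deg A S ≡ 0 ⊎ α ≤ deg A S)
      × (length (H ∖ A) ≤ (α ∸ 1) * length B)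
      × (length B ≤ traceSum B)
theorem3p2 α k _ _ H (H! , _) =
  let T , P , closed = peel α H in
  survivors H T , map proj₂ T ,
  (survivors-unique H H! T , All.tabulate (survivors-⊆ H T)) ,
  (peeling-elements-unique α H P , peeling-elements-∈ α H P) ,
  (λ _ → survivors-disjoint-tagged H) ,
  (λ S _ |S|≡k _ → closed⇒deg closed S |S|≡k) ,
  peeling-removed≤ H! P ,
  length≤traceSum T (peeling-classes-unique α H P)
  where open Peeling (≡-dec _≟_) (trace {k})
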